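{- Let $H=(V,\mathcal{E})$ be a hypergraph with maximum degree $\Delta$ whose hyperedges all have size at most $k$. Let $B\subseteq\mathcal{E}$ be a set of hyperedges inducing a connected subgraph of $\mathrm{L}^2(H)$, and let $e^*\in B$. Then there exists a $\{2,3\}$-tree $T\subseteq B$ in $\mathrm{Lin}(H)$ with $e^*\in T$ and $|T|\ge\frac{|B|}{k\Delta}$.
   Context: $\mathrm{Lin}(H)$ is the line graph of $H$: its vertices are the hyperedges of $H$, two being adjacent if they share a vertex. $\mathrm{L}^2(H)$ is the graph on the hyperedges of $H$ in which two distinct hyperedges are adjacent if their distance in $\mathrm{Lin}(H)$ is at most $2$. A set $T$ of vertices of a graph $G$ is a $\{2,3\}$-tree if any two distinct elements of $T$ are at distance at least $2$ in $G$, and the graph on $T$ joining pairs at distance $2$ or $3$ in $G$ is connected. -}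

module Defs where

open import Data.Nat using (ℕ; zero; suc; _≤_)
open import Data.Fin using (Fin)
open import Data.Fin.Subset using (Subset; _∈_; _∉_; ∣_∣)
open import Data.Vec using (tabulate; lookup)
open import Data.Product using (Σ; _×_; ∃; ∃-syntax)
open import Relation.Binary.PropositionalEquality using (_≡_)
open import Relation.Nullary using (¬_)
open import Relation.Binary.Construct.Closure.ReflexiveTransitive using (Star)

record Hypergraph (n m : ℕ) : Set where
  field
    edges : Fin m → Subset n

open Hypergraph public

size : ∀ {n m} → Hypergraph n m → Fin m → ℕ
size H e = ∣ edges H e ∣

-- degree of a vertex: number of hyperedges containing it
degree : ∀ {n m} → Hypergraph n m → Fin n → ℕ
degree H v = ∣ tabulate (λ e → lookup (edges H e) v) ∣

LinAdj : ∀ {n m} → Hypergraph n m → Fin m → Fin m → Set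
LinAdj H e f = ¬ (e ≡ f) × ∃[ v ] (v ∈ edges H e × v ∈ edges H f)

data Walk {A : Set} (R : A → A → Set) : ℕ → A → A → Set where
  here : ∀ {x} → Walk R zero x x
  step : ∀ {l x y z} → R x y → Walk R l y z → Walk R (suc l) x z

DistLe : {A : Set} → (A → A → Set) → ℕ → A → A → Set
DistLe R d x y = ∃[ l ] (l ≤ d × Walk R l x y)

L2Adj : ∀ {n m} → Hypergraph n m → Fin m → Fin m → Set
L2Adj H e f = ¬ (e ≡ f) × DistLe (LinAdj H) 2 e f

InducedConnected : {A : Set} → (A → A → Set) → (A → Set) → Set
InducedConnected R S =
  ∀ x y → S x → S y → Star (λ a b → S a × S b × R a b) x y

TwoThreeTree : ∀ {n m} → Hypergraph n m → Subset m → Set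
TwoThreeTree H T =
  (∀ e f → e ∈ T → f ∈ T → ¬ (e ≡ f) → ¬ DistLe (LinAdj H) 1 e f)
  × InducedConnected
      (λ e f → DistLe (LinAdj H) 3 e f × ¬ DistLe (LinAdj H) 1 e f)
      (λ e → e ∈ T)

-- Grow T greedily from {e*}: as long as some hyperedge of B is not dominated by T (at
-- Lin-distance ≥ 2 from all of T), walk from e* to it in L²(H)[B]. The first undominated
-- hyperedge b on that walk follows a dominated one, so b is at distance ≤ 1 + 2 = 3 from some
-- t ∈ T and at distance ≥ 2 from all of T; adding b keeps T a {2,3}-tree. At the end T
-- dominates B, and the closed Lin-neighbourhood of a hyperedge t is the union over the at most
-- k vertices v ∈ t of the at most Δ hyperedges through v, whence |B| ≤ kΔ|T|.
module Submission where

open import Defs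
open import Data.Nat using (ℕ; zero; suc; _≤_; _<_; _*_; _+_; z≤n; s≤s)
open import Data.Nat.Properties
  using (≤-trans; ≤-reflexive; +-mono-≤; +-monoʳ-≤; +-monoˡ-≤; +-suc; +-identityʳ; n≤1+n;
         *-monoʳ-≤; *-suc; *-comm; <⇒≱; m≤n+m)
open import Data.Fin using (Fin; zero; suc)
open import Data.Fin.Properties using (any?) renaming (_≟_ to _≟ᶠ_)
open import Data.Fin.Subset using (Subset; inside; outside; _∈_; _∉_; _⊆_; ∣_∣; _∪_; ⁅_⁆; ⊥)
open import Data.Fin.Subset.Properties
  using (_∈?_; x∈p∪q⁻; x∈⁅x⁆; x∈⁅y⁆⇒x≡y; p⊆q⇒∣p∣≤∣q∣; p⊂q⇒∣p∣<∣q∣; ∣p∣≤n; ∣⊥∣≡0; p⊆p∪q; q⊆p∪q)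
open import Data.Vec using ([]; _∷_; tabulate; lookup; here; there)
open import Data.Vec.Properties using (lookup∘tabulate; []=⇒lookup; lookup⇒[]=)
open import Data.Product using (_×_; ∃-syntax; _,_)
open import Data.Sum using (_⊎_; inj₁; inj₂)
open import Data.Empty using (⊥-elim)
open import Function.Definitions using (Injective)
open import Relation.Binary.PropositionalEquality using (_≡_; refl; sym; trans)
open import Relation.Binary.Definitions using (Symmetric) renaming (Decidable to Decidable₂)
open import Relation.Unary using (Decidable)
open import Relation.Nullary using (¬_; yes; no)
open import Relation.Nullary.Decidable using (_×-dec_; _⊎-dec_; ¬?; decidable-stable)
open import Relation.Binary.Construct.Closure.ReflexiveTransitive
  using (Star; ε; _◅_; _◅◅_) renaming (map to Star-map)

module _ {A : Set} {R : A → A → Set} where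

  walk-snoc : ∀ {l x y z} → Walk R l x y → R y z → Walk R (suc l) x z
  walk-snoc here r = step r here
  walk-snoc (step r w) r′ = step r (walk-snoc w r′)

  walk-++ : ∀ {k l x y z} → Walk R k x y → Walk R l y z → Walk R (k + l) x z
  walk-++ here w = w
  walk-++ (step r w) w′ = step r (walk-++ w w′)

  walk-reverse : Symmetric R → ∀ {l x y} → Walk R l x y → Walk R l y x
  walk-reverse sym-R here = here
  walk-reverse sym-R (step r w) = walk-snoc (walk-reverse sym-R w) (sym-R r)

  distLe-sym : Symmetric R → ∀ {d x y} → DistLe R d x y → DistLe R d y x
  distLe-sym sym-R (l , l≤d , w) = l , l≤d , walk-reverse sym-R w

  distLe-trans : ∀ {c d x y z} → DistLe R c x y → DistLe R d y z → DistLe R (c + d) x z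
  distLe-trans (k , k≤c , w) (l , l≤d , w′) = k + l , +-mono-≤ k≤c l≤d , walk-++ w w′

  star-exit : {P : A → Set} → Decidable P → ∀ {x y} → Star R x y → P x → ¬ P y
    → ∃[ a ] ∃[ b ] (R a b × P a × ¬ P b)
  star-exit P? ε Px ¬Py = ⊥-elim (¬Py Px)
  star-exit P? (_◅_ {i = x} {j = z} r rest) Px ¬Py with P? z
  ... | yes Pz = star-exit P? rest Pz ¬Py
  ... | no ¬Pz = x , z , r , Px , ¬Pz

x∈p∪⁅y⁆⁻ : ∀ {n} (p : Subset n) (y : Fin n) {x} → x ∈ p ∪ ⁅ y ⁆ → x ∈ p ⊎ x ≡ y
x∈p∪⁅y⁆⁻ p y x∈ with x∈p∪q⁻ p ⁅ y ⁆ x∈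
... | inj₁ x∈p = inj₁ x∈p
... | inj₂ x∈⁅y⁆ = inj₂ (x∈⁅y⁆⇒x≡y y x∈⁅y⁆)

∣p∪q∣≤∣p∣+∣q∣ : ∀ {n} (p q : Subset n) → ∣ p ∪ q ∣ ≤ ∣ p ∣ + ∣ q ∣
∣p∪q∣≤∣p∣+∣q∣ [] [] = z≤n
∣p∪q∣≤∣p∣+∣q∣ (inside ∷ p) (inside ∷ q) =
  s≤s (≤-trans (∣p∪q∣≤∣p∣+∣q∣ p q) (+-monoʳ-≤ ∣ p ∣ (n≤1+n ∣ q ∣)))
∣p∪q∣≤∣p∣+∣q∣ (inside ∷ p) (outside ∷ q) = s≤s (∣p∪q∣≤∣p∣+∣q∣ p q)
∣p∪q∣≤∣p∣+∣q∣ (outside ∷ p) (inside ∷ q) =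
  ≤-trans (s≤s (∣p∪q∣≤∣p∣+∣q∣ p q)) (≤-reflexive (sym (+-suc ∣ p ∣ ∣ q ∣)))
∣p∪q∣≤∣p∣+∣q∣ (outside ∷ p) (outside ∷ q) = ∣p∪q∣≤∣p∣+∣q∣ p q

⋃[_]_ : ∀ {p n} → Subset p → (Fin p → Subset n) → Subset n
⋃[ [] ] F = ⊥
⋃[ inside ∷ I ] F = F zero ∪ ⋃[ I ] (λ i → F (suc i))
⋃[ outside ∷ I ] F = ⋃[ I ] (λ i → F (suc i))

∈-⋃ : ∀ {p n} (I : Subset p) (F : Fin p → Subset n) {i x} → i ∈ I → x ∈ F i → x ∈ ⋃[ I ] F
∈-⋃ (inside ∷ I) F here x∈ = p⊆p∪q (⋃[ I ] (λ i → F (suc i))) x∈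
∈-⋃ (inside ∷ I) F (there i∈I) x∈ =
  q⊆p∪q (F zero) (⋃[ I ] (λ i → F (suc i))) (∈-⋃ I (λ i → F (suc i)) i∈I x∈)
∈-⋃ (outside ∷ I) F (there i∈I) x∈ = ∈-⋃ I (λ i → F (suc i)) i∈I x∈

∣⋃∣≤ : ∀ {p n} (I : Subset p) (F : Fin p → Subset n) {c}
  → (∀ {i} → i ∈ I → ∣ F i ∣ ≤ c) → ∣ ⋃[ I ] F ∣ ≤ c * ∣ I ∣
∣⋃∣≤ {n = n} [] F {c} bound =
  ≤-trans (≤-reflexive (∣⊥∣≡0 n)) z≤n
∣⋃∣≤ (inside ∷ I) F {c} bound =
  ≤-trans (∣p∪q∣≤∣p∣+∣q∣ (F zero) (⋃[ I ] (λ i → F (suc i))))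
    (≤-trans (+-mono-≤ (bound here) (∣⋃∣≤ I (λ i → F (suc i)) (λ i∈I → bound (there i∈I))))
      (≤-reflexive (sym (*-suc c ∣ I ∣))))
∣⋃∣≤ (outside ∷ I) F bound = ∣⋃∣≤ I (λ i → F (suc i)) (λ i∈I → bound (there i∈I))

module _ {n m : ℕ} (H : Hypergraph n m) where

  Meet : Fin m → Fin m → Set
  Meet e f = ∃[ v ] (v ∈ edges H e × v ∈ edges H f)

  meet? : Decidable₂ Meet
  meet? e f = any? (λ v → (v ∈? edges H e) ×-dec (v ∈? edges H f))

  Close : Fin m → Fin m → Set
  Close e f = e ≡ f ⊎ Meet e f

  close? : Decidable₂ Close
  close? e f = (e ≟ᶠ f) ⊎-dec meet? e f

  LinDist : ℕ → Fin m → Fin m → Set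
  LinDist = DistLe (LinAdj H)

  linAdj-sym : Symmetric (LinAdj H)
  linAdj-sym (e≢f , v , v∈e , v∈f) = (λ e≡f → e≢f (sym e≡f)) , v , v∈f , v∈e

  linDist-sym : ∀ {d e f} → LinDist d e f → LinDist d f e
  linDist-sym = distLe-sym linAdj-sym

  linDist≤1⇒close : ∀ {e f} → LinDist 1 e f → Close e f
  linDist≤1⇒close (zero , _ , here) = inj₁ refl
  linDist≤1⇒close (suc zero , _ , step (_ , meet) here) = inj₂ meet
  linDist≤1⇒close (suc (suc _) , s≤s () , _)

  close⇒linDist≤1 : ∀ {e f} → Close e f → LinDist 1 e f
  close⇒linDist≤1 (inj₁ refl) = 0 , z≤n , here
  close⇒linDist≤1 {e} {f} (inj₂ meet) with e ≟ᶠ f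
  ... | yes refl = 0 , z≤n , here
  ... | no e≢f = 1 , s≤s z≤n , step (e≢f , meet) here

  Dominates : Subset m → Fin m → Set
  Dominates T f = ∃[ t ] (t ∈ T × Close t f)

  dominates? : ∀ T → Decidable (Dominates T)
  dominates? T f = any? (λ t → (t ∈? T) ×-dec close? t f)

  TreePath : Subset m → Fin m → Fin m → Set
  TreePath T = Star (λ e f → e ∈ T × f ∈ T × (LinDist 3 e f × ¬ LinDist 1 e f))

  twoThreeTree-⁅⁆ : ∀ e → TwoThreeTree H ⁅ e ⁆
  twoThreeTree-⁅⁆ e = separated , connected
    where
    separated : ∀ x y → x ∈ ⁅ e ⁆ → y ∈ ⁅ e ⁆ → ¬ x ≡ y → ¬ LinDist 1 x y
    separated x y x∈ y∈ x≢y _ = x≢y (trans (x∈⁅y⁆⇒x≡y e x∈) (sym (x∈⁅y⁆⇒x≡y e y∈)))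
    connected : ∀ x y → x ∈ ⁅ e ⁆ → y ∈ ⁅ e ⁆ → TreePath ⁅ e ⁆ x y
    connected x y x∈ y∈ with x∈⁅y⁆⇒x≡y e x∈ | x∈⁅y⁆⇒x≡y e y∈
    ... | refl | refl = ε

  -- The new hyperedge b is joined in the {2,3}-graph to t, through which it reaches all of T.
  twoThreeTree-∪⁅⁆ : ∀ {T t b} → TwoThreeTree H T → t ∈ T → LinDist 3 t b → ¬ Dominates T b
    → TwoThreeTree H (T ∪ ⁅ b ⁆)
  twoThreeTree-∪⁅⁆ {T} {t} {b} (separated , connected) t∈T t~b b∉NT = separated′ , connected′
    where
    T′ = T ∪ ⁅ b ⁆
    ⊆T′ : T ⊆ T′
    ⊆T′ = p⊆p∪q ⁅ b ⁆
    b∈T′ : b ∈ T′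
    b∈T′ = q⊆p∪q T ⁅ b ⁆ (x∈⁅x⁆ b)
    far : ∀ {s} → s ∈ T → ¬ LinDist 1 s b
    far s∈T d = b∉NT (_ , s∈T , linDist≤1⇒close d)
    far′ : ∀ {s} → s ∈ T → ¬ LinDist 1 b s
    far′ s∈T d = far s∈T (linDist-sym d)
    separated′ : ∀ e f → e ∈ T′ → f ∈ T′ → ¬ e ≡ f → ¬ LinDist 1 e f
    separated′ e f e∈ f∈ e≢f with x∈p∪⁅y⁆⁻ T b e∈ | x∈p∪⁅y⁆⁻ T b f∈
    ... | inj₁ e∈T | inj₁ f∈T = separated e f e∈T f∈T e≢f
    ... | inj₁ e∈T | inj₂ refl = far e∈T
    ... | inj₂ refl | inj₁ f∈T = far′ f∈T
    ... | inj₂ refl | inj₂ refl = ⊥-elim (e≢f refl)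
    lift : ∀ {x y} → TreePath T x y → TreePath T′ x y
    lift = Star-map (λ { (e∈ , f∈ , e~f) → ⊆T′ e∈ , ⊆T′ f∈ , e~f })
    to-t : ∀ x → x ∈ T′ → TreePath T′ x t
    to-t x x∈ with x∈p∪⁅y⁆⁻ T b x∈
    ... | inj₁ x∈T = lift (connected x t x∈T t∈T)
    ... | inj₂ refl = (b∈T′ , ⊆T′ t∈T , linDist-sym t~b , far′ t∈T) ◅ ε
    from-t : ∀ x → x ∈ T′ → TreePath T′ t x
    from-t x x∈ with x∈p∪⁅y⁆⁻ T b x∈
    ... | inj₁ x∈T = lift (connected t x t∈T x∈T)
    ... | inj₂ refl = (⊆T′ t∈T , b∈T′ , t~b , far t∈T) ◅ ε
    connected′ : ∀ x y → x ∈ T′ → y ∈ T′ → TreePath T′ x y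
    connected′ x y x∈ y∈ = to-t x x∈ ◅◅ from-t y y∈

  RootedTree : Subset m → Fin m → Subset m → Set
  RootedTree B e* T = T ⊆ B × e* ∈ T × TwoThreeTree H T

  module _ {B : Subset m} {e* : Fin m} (B-connected : InducedConnected (L2Adj H) (_∈ B)) where

    extend : ∀ {T f} → RootedTree B e* T → f ∈ B → ¬ Dominates T f
      → ∃[ b ] (b ∉ T × RootedTree B e* (T ∪ ⁅ b ⁆))
    extend {T} {f} (T⊆B , e*∈T , tree) f∈B f∉NT
      with star-exit (dominates? T) (B-connected e* f (T⊆B e*∈T) f∈B) (e* , e*∈T , inj₁ refl) f∉NT
    ... | a , b , (_ , b∈B , _ , a~b) , (t , t∈T , t~a) , b∉NT =
      b , (λ b∈T → b∉NT (b , b∈T , inj₁ refl)) ,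
      T′⊆B , p⊆p∪q ⁅ b ⁆ e*∈T , twoThreeTree-∪⁅⁆ tree t∈T t~b b∉NT
      where
      t~b : LinDist 3 t b
      t~b = distLe-trans (close⇒linDist≤1 t~a) a~b
      T′⊆B : T ∪ ⁅ b ⁆ ⊆ B
      T′⊆B x∈ with x∈p∪⁅y⁆⁻ T b x∈
      ... | inj₁ x∈T = T⊆B x∈T
      ... | inj₂ refl = b∈B

    -- Each extension strictly enlarges T ⊆ Fin m, so m + 1 steps of fuel cannot run out.
    grow : ∀ fuel {T} → m ≤ ∣ T ∣ + fuel → RootedTree B e* T
      → ∃[ T′ ] (RootedTree B e* T′ × (∀ {f} → f ∈ B → Dominates T′ f))
    grow fuel {T} bound rooted with any? (λ f → (f ∈? B) ×-dec ¬? (dominates? T f))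
    ... | no none =
      T , rooted , λ {f} f∈B → decidable-stable (dominates? T f) (λ f∉NT → none (f , f∈B , f∉NT))
    ... | yes (f , f∈B , f∉NT) with extend rooted f∈B f∉NT
    ... | b , b∉T , rooted′ = continue fuel bound
      where
      ∣T∣<∣T′∣ : ∣ T ∣ < ∣ T ∪ ⁅ b ⁆ ∣
      ∣T∣<∣T′∣ = p⊂q⇒∣p∣<∣q∣ (p⊆p∪q ⁅ b ⁆ , b , q⊆p∪q T ⁅ b ⁆ (x∈⁅x⁆ b) , b∉T)
      continue : ∀ fuel → m ≤ ∣ T ∣ + fuel
        → ∃[ T′ ] (RootedTree B e* T′ × (∀ {f} → f ∈ B → Dominates T′ f))
      continue zero bound = ⊥-elim (<⇒≱ ∣T∣<∣T′∣
        (≤-trans (∣p∣≤n (T ∪ ⁅ b ⁆)) (≤-trans bound (≤-reflexive (+-identityʳ ∣ T ∣)))))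
      continue (suc fuel) bound = grow fuel
        (≤-trans bound (≤-trans (≤-reflexive (+-suc ∣ T ∣ fuel)) (+-monoˡ-≤ fuel ∣T∣<∣T′∣)))
        rooted′

    dominating-tree : e* ∈ B → ∃[ T ] (RootedTree B e* T × (∀ {f} → f ∈ B → Dominates T f))
    dominating-tree e*∈B =
      grow m (m≤n+m m ∣ ⁅ e* ⁆ ∣) (⊆B , x∈⁅x⁆ e* , twoThreeTree-⁅⁆ e*)
      where
      ⊆B : ⁅ e* ⁆ ⊆ B
      ⊆B x∈ with x∈⁅y⁆⇒x≡y e* x∈
      ... | refl = e*∈B

  -- ∣ incident v ∣ is definitionally degree H v.
  incident : Fin n → Subset m
  incident v = tabulate (λ e → lookup (edges H e) v)

  ∈-incident : ∀ {v f} → v ∈ edges H f → f ∈ incident v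
  ∈-incident {v} {f} v∈f =
    lookup⇒[]= f (incident v) (trans (lookup∘tabulate (λ e → lookup (edges H e) v) f) ([]=⇒lookup v∈f))

  closedNbhd : Fin m → Subset m
  closedNbhd t = ⋃[ edges H t ] incident

  close⇒∈closedNbhd : ∀ {t f} → ∃[ v ] (v ∈ edges H t) → Close t f → f ∈ closedNbhd t
  close⇒∈closedNbhd {t} (v , v∈t) (inj₁ refl) = ∈-⋃ (edges H t) incident v∈t (∈-incident v∈t)
  close⇒∈closedNbhd {t} _ (inj₂ (v , v∈t , v∈f)) = ∈-⋃ (edges H t) incident v∈t (∈-incident v∈f)

  ∣closedNbhd∣≤ : ∀ {Δ k t} → (∀ v → degree H v ≤ Δ) → size H t ≤ k → ∣ closedNbhd t ∣ ≤ k * Δ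
  ∣closedNbhd∣≤ {Δ} {k} {t} degree≤ size≤ =
    ≤-trans (∣⋃∣≤ (edges H t) incident (λ {v} _ → degree≤ v))
      (≤-trans (*-monoʳ-≤ Δ size≤) (≤-reflexive (*-comm Δ k)))

  ∣dominated∣≤ : ∀ {Δ k} → (∀ e → ∃[ v ] (v ∈ edges H e)) → (∀ v → degree H v ≤ Δ)
    → (∀ e → size H e ≤ k) → ∀ {B T} → (∀ {f} → f ∈ B → Dominates T f) → ∣ B ∣ ≤ k * Δ * ∣ T ∣
  ∣dominated∣≤ nonempty degree≤ size≤ {B} {T} dominated =
    ≤-trans (p⊆q⇒∣p∣≤∣q∣ B⊆⋃) (∣⋃∣≤ T closedNbhd (λ {t} _ → ∣closedNbhd∣≤ degree≤ (size≤ t)))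
    where
    B⊆⋃ : B ⊆ ⋃[ T ] closedNbhd
    B⊆⋃ f∈B with dominated f∈B
    ... | t , t∈T , t~f = ∈-⋃ T closedNbhd t∈T (close⇒∈closedNbhd (nonempty t) t~f)

lemma4p5 : ∀ {n m} (H : Hypergraph n m) (Δ k : ℕ)
    → Injective _≡_ _≡_ (edges H)
    → (∀ e → ∃[ v ] (v ∈ edges H e))
    → (∀ v → degree H v ≤ Δ)
    → (∀ e → size H e ≤ k)
    → (B : Subset m)
    → InducedConnected (L2Adj H) (λ e → e ∈ B)
    → (e* : Fin m) → e* ∈ B
    → ∃[ T ] (T ⊆ B × e* ∈ T × TwoThreeTree H T × ∣ B ∣ ≤ k * Δ * ∣ T ∣)
lemma4p5 H Δ k _ nonempty degree≤ size≤ B B-connected e* e*∈B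
  with dominating-tree H B-connected e*∈B
... | T , (T⊆B , e*∈T , tree) , dominated =
  T , T⊆B , e*∈T , tree , ∣dominated∣≤ H nonempty degree≤ size≤ dominated
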